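{- For integers $k\ge0$ and $n\ge2k+1$, \[ \left\langle {n \atop k}\right\rangle_3=\left\langle {n-1 \atop k}\right\rangle_3+\left\langle {n-1 \atop k-1}\right\rangle_3. \]
   Context: An $N$-board is a linear array of $N$ unit cells. A square is a $1\times1$ tile; a $(1,2)$-fence is a tile consisting of two unit square posts separated by a gap of width $2$, whose gap may be occupied by other tiles (including posts of other fences). For integers $n,k$, $\left\langle {n \atop k}\right\rangle_3$ denotes the number of tilings of an $(n+k)$-board using exactly $k$ $(1,2)$-fences and $n-k$ squares; it is $0$ if $k<0$ or $k>n$. -}

module Defs where

open import Data.Nat using (ℕ; zero; suc; _+_; _<ᵇ_)
open import Data.Integer using (ℤ; +_; -[1+_])
open import Data.Bool using (Bool; true; false; _∧_; if_then_else_)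
open import Data.List using (List; []; _∷_; length; filter; concatMap; map; upTo)
open import Data.Maybe using (Maybe; just; nothing)
open import Relation.Nullary.Decidable using (Dec; yes; no)
open import Relation.Binary.PropositionalEquality using (_≡_)
open import Data.Bool.Properties using () renaming (_≟_ to _≟ᵇ_)

-- A tiling of an N-board is encoded cell by cell: each cell is covered by
-- a square, the left post of a (1,2)-fence, or the right post of a
-- (1,2)-fence.  A (1,2)-fence occupies cells i and i+3 (gap of width 2).
data Cell : Set where
  sq post₁ post₂ : Cell

isPost₁ : Maybe Cell → Bool
isPost₁ (just post₁) = true
isPost₁ _ = false

isPost₂ : Maybe Cell → Bool
isPost₂ (just post₂) = true
isPost₂ _ = false

at : List Cell → ℕ → Maybe Cell
at [] _ = nothing
at (c ∷ cs) zero = just c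
at (c ∷ cs) (suc i) = at cs i

eqB : Bool → Bool → Bool
eqB true b = b
eqB false true = false
eqB false false = true

not : Bool → Bool
not true = false
not false = true

all : {A : Set} → (A → Bool) → List A → Bool
all p [] = true
all p (x ∷ xs) = p x ∧ all p xs

-- Validity: for every cell position i, cell i is a left post iff cell i+3
-- is a right post (so posts pair up into fences lying on the board), and
-- none of the cells 0,1,2 is a right post.
ValidTiling : List Cell → Bool
ValidTiling t =
  all (λ i → eqB (isPost₁ (at t i)) (isPost₂ (at t (3 + i)))) (upTo (length t))
  ∧ all (λ i → not (isPost₂ (at t i))) (upTo 3)

fences : List Cell → ℕ
fences [] = 0
fences (post₁ ∷ cs) = suc (fences cs)
fences (_ ∷ cs) = fences cs

boards : ℕ → List (List Cell)
boards zero = [] ∷ []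
boards (suc N) = concatMap (λ t → (sq ∷ t) ∷ (post₁ ∷ t) ∷ (post₂ ∷ t) ∷ []) (boards N)

eqℕ : ℕ → ℕ → Bool
eqℕ zero zero = true
eqℕ zero (suc _) = false
eqℕ (suc _) zero = false
eqℕ (suc m) (suc n) = eqℕ m n

tilings : ℕ → ℕ → ℕ
tilings N k =
  length (filter (λ t → (ValidTiling t ∧ eqℕ (fences t) k) ≟ᵇ true) (boards N))

-- ⟨ n , k ⟩₃ : tilings of an (n+k)-board with exactly k fences and
-- n-k squares; 0 if k < 0 or k > n (for k > n there is no such tiling,
-- since 2k post cells exceed n+k cells).
⟨_,_⟩₃ : ℤ → ℤ → ℕ
⟨ -[1+ _ ] , _ ⟩₃ = 0
⟨ + _ , -[1+ _ ] ⟩₃ = 0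
⟨ + n , + k ⟩₃ = tilings (n + k) k

-- Reading a tiling cell by cell, the only memory needed is which of the next
-- three cells must be right posts of fences already begun, so tilings are
-- counted by an automaton with three bits of state. On an (N+2)-board the
-- first cell is a square, leaving an (N+1)-board, or a left post, leaving an
-- (N+1)-board whose cell 2 is owed a right post. When there is room for the
-- remaining fences, such an owed post costs exactly one cell, so the second
-- count is that of an unconstrained N-board; this is proved together with the
-- recurrence by induction on the number of fences.

module Submission where

open import Defs
open import Data.Nat using () renaming (_+_ to _+ℕ_)
open import Data.Integer using (ℤ; +_; _+_; _-_; _*_; _≤_)
open import Relation.Binary.PropositionalEquality using (_≡_)

open import Data.Bool using (Bool; true; false; _∧_; if_then_else_)
open import Data.Bool.Properties using (∧-commutativeMonoid; ∧-zeroʳ) renaming (_≟_ to _≟ᵇ_)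
open import Algebra.Solver.CommutativeMonoid ∧-commutativeMonoid using (solve; _⊜_; _⊕_)
open import Data.Integer using (+≤+)
open import Data.List using (List; []; _∷_; length; filter; concatMap; applyUpTo; upTo)
open import Data.Maybe using (just)
open import Data.Nat using (ℕ; zero; suc; s≤s) renaming (_*_ to _*ℕ_; _≤_ to _≤ℕ_)
open import Data.Nat.Properties using (<⇒≤; +-identityʳ; +-suc; +-monoˡ-≤; ≤-pred)
open import Data.Nat.Tactic.RingSolver using (solve-∀)
open import Relation.Binary.PropositionalEquality using (refl; sym; trans; cong; cong₂; subst; module ≡-Reasoning)

private variable
  A B : Set

count : (A → Bool) → List A → ℕ
count P xs = length (filter (λ x → P x ≟ᵇ true) xs)

count-∷ : ∀ (P : A → Bool) x xs → count P (x ∷ xs) ≡ (if P x then 1 else 0) +ℕ count P xs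
count-∷ P x xs with P x
... | true  = refl
... | false = refl

count-cong : ∀ {P Q : A → Bool} → (∀ x → P x ≡ Q x) → ∀ xs → count P xs ≡ count Q xs
count-cong P≗Q []       = refl
count-cong {P = P} {Q} P≗Q (x ∷ xs) = begin
  count P (x ∷ xs)                          ≡⟨ count-∷ P x xs ⟩
  (if P x then 1 else 0) +ℕ count P xs      ≡⟨ cong₂ (λ b n → (if b then 1 else 0) +ℕ n) (P≗Q x) (count-cong P≗Q xs) ⟩
  (if Q x then 1 else 0) +ℕ count Q xs      ≡⟨ sym (count-∷ Q x xs) ⟩
  count Q (x ∷ xs)                          ∎
  where open ≡-Reasoning

count-false : ∀ xs → count (λ (_ : A) → false) xs ≡ 0
count-false []       = refl
count-false (_ ∷ xs) = count-false xs

count-concatMap₃ : ∀ {A B : Set} (P : B → Bool) (f g h : A → B) xs →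
  count P (concatMap (λ x → f x ∷ g x ∷ h x ∷ []) xs)
    ≡ count (λ x → P (f x)) xs +ℕ count (λ x → P (g x)) xs +ℕ count (λ x → P (h x)) xs
count-concatMap₃ P f g h []       = refl
count-concatMap₃ {A} {B} P f g h (x ∷ xs) = begin
  count P (f x ∷ g x ∷ h x ∷ rest)                  ≡⟨ count-∷ P (f x) _ ⟩
  [ f ] +ℕ count P (g x ∷ h x ∷ rest)               ≡⟨ cong ([ f ] +ℕ_) (count-∷ P (g x) _) ⟩
  [ f ] +ℕ ([ g ] +ℕ count P (h x ∷ rest))          ≡⟨ cong (λ n → [ f ] +ℕ ([ g ] +ℕ n)) (count-∷ P (h x) _) ⟩
  [ f ] +ℕ ([ g ] +ℕ ([ h ] +ℕ count P rest))       ≡⟨ cong (λ n → [ f ] +ℕ ([ g ] +ℕ ([ h ] +ℕ n))) (count-concatMap₃ P f g h xs) ⟩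
  [ f ] +ℕ ([ g ] +ℕ ([ h ] +ℕ (# f +ℕ # g +ℕ # h))) ≡⟨ interchange [ f ] [ g ] [ h ] (# f) (# g) (# h) ⟩
  ([ f ] +ℕ # f) +ℕ ([ g ] +ℕ # g) +ℕ ([ h ] +ℕ # h) ≡⟨ sym (cong₂ _+ℕ_ (cong₂ _+ℕ_ (step f) (step g)) (step h)) ⟩
  count (λ y → P (f y)) (x ∷ xs) +ℕ count (λ y → P (g y)) (x ∷ xs) +ℕ count (λ y → P (h y)) (x ∷ xs) ∎
  where
  open ≡-Reasoning
  rest : List B
  rest = concatMap (λ x → f x ∷ g x ∷ h x ∷ []) xs
  [_] : (A → B) → ℕ
  [ e ] = if P (e x) then 1 else 0
  # : (A → B) → ℕ
  # e = count (λ y → P (e y)) xs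
  step : ∀ e → count (λ y → P (e y)) (x ∷ xs) ≡ [ e ] +ℕ # e
  step e = count-∷ (λ y → P (e y)) x xs
  interchange : ∀ a b c d e f → a +ℕ (b +ℕ (c +ℕ (d +ℕ e +ℕ f))) ≡ (a +ℕ d) +ℕ (b +ℕ e) +ℕ (c +ℕ f)
  interchange = solve-∀

postsMatched : List Cell → Bool
postsMatched t = all (λ i → eqB (isPost₁ (at t i)) (isPost₂ (at t (3 +ℕ i)))) (upTo (length t))

all-applyUpTo-∘ : ∀ (P : ℕ → Bool) (g f : ℕ → ℕ) n →
  all P (applyUpTo (λ i → g (f i)) n) ≡ all (λ i → P (g i)) (applyUpTo f n)
all-applyUpTo-∘ P g f zero    = refl
all-applyUpTo-∘ P g f (suc n) = cong (P (g (f 0)) ∧_) (all-applyUpTo-∘ P g (λ i → f (suc i)) n)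

postsMatched-∷ : ∀ x u → postsMatched (x ∷ u) ≡ eqB (isPost₁ (just x)) (isPost₂ (at u 2)) ∧ postsMatched u
postsMatched-∷ x u = cong (eqB (isPost₁ (just x)) (isPost₂ (at u 2)) ∧_) (all-applyUpTo-∘ _ suc (λ i → i) (length u))

-- ValidSuffix a b c t: t can follow a tiled prefix whose fences require right
-- posts exactly at those of the cells 0, 1, 2 of t that are flagged by a, b, c.
ValidSuffix : Bool → Bool → Bool → List Cell → Bool
ValidSuffix a b c t =
  postsMatched t ∧ (eqB a (isPost₂ (at t 0)) ∧ (eqB b (isPost₂ (at t 1)) ∧ eqB c (isPost₂ (at t 2))))

validTiling≡validSuffix : ∀ t → ValidTiling t ≡ ValidSuffix false false false t
validTiling≡validSuffix t = cong (postsMatched t ∧_) (noneFlagged (isPost₂ (at t 0)) (isPost₂ (at t 1)) (isPost₂ (at t 2)))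
  where
  noneFlagged : ∀ p q r → not p ∧ (not q ∧ (not r ∧ true)) ≡ eqB false p ∧ (eqB false q ∧ eqB false r)
  noneFlagged true  q     r     = refl
  noneFlagged false true  r     = refl
  noneFlagged false false true  = refl
  noneFlagged false false false = refl

validSuffix-∷ : ∀ a b c x u →
  ValidSuffix a b c (x ∷ u) ≡ eqB a (isPost₂ (just x)) ∧ ValidSuffix b c (isPost₁ (just x)) u
validSuffix-∷ a b c x u = trans (cong (_∧ flags) (postsMatched-∷ x u))
  (reorder (eqB (isPost₁ (just x)) (isPost₂ (at u 2))) (postsMatched u) (eqB a (isPost₂ (just x)))
           (eqB b (isPost₂ (at u 0))) (eqB c (isPost₂ (at u 1))))
  where
  flags : Bool
  flags = eqB a (isPost₂ (just x)) ∧ (eqB b (isPost₂ (at u 0)) ∧ eqB c (isPost₂ (at u 1)))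
  reorder : ∀ h m e p q → (h ∧ m) ∧ (e ∧ (p ∧ q)) ≡ e ∧ (m ∧ (p ∧ (q ∧ h)))
  reorder = solve 5 (λ h m e p q → (h ⊕ m) ⊕ (e ⊕ (p ⊕ q)) ⊜ e ⊕ (m ⊕ (p ⊕ (q ⊕ h)))) refl

-- Reading a board cell by cell, the state a b c flags the next three cells that
-- must be right posts, and k counts the fences still to be started.
accepts : Bool → Bool → Bool → ℕ → List Cell → Bool
accepts false b c k       (sq    ∷ t) = accepts b c false k t
accepts false b c (suc k) (post₁ ∷ t) = accepts b c true k t
accepts true  b c k       (post₂ ∷ t) = accepts b c false k t
accepts false false false zero [] = true
accepts _ _ _ _ _ = false

validSuffix-accepts : ∀ a b c k t → ValidSuffix a b c t ∧ eqℕ (fences t) k ≡ accepts a b c k t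
validSuffix-accepts true  b     c     k       [] = refl
validSuffix-accepts false true  c     k       [] = refl
validSuffix-accepts false false true  k       [] = refl
validSuffix-accepts false false false zero    [] = refl
validSuffix-accepts false false false (suc k) [] = refl
validSuffix-accepts a b c k (x ∷ u) =
  trans (cong (_∧ eqℕ (fences (x ∷ u)) k) (validSuffix-∷ a b c x u)) (readCell a x k)
  where
  readCell : ∀ a x k →
    (eqB a (isPost₂ (just x)) ∧ ValidSuffix b c (isPost₁ (just x)) u) ∧ eqℕ (fences (x ∷ u)) k
      ≡ accepts a b c k (x ∷ u)
  readCell false sq    k       = validSuffix-accepts b c false k u
  readCell false post₁ zero    = ∧-zeroʳ (ValidSuffix b c true u)
  readCell false post₁ (suc k) = validSuffix-accepts b c true k u
  readCell false post₂ k       = refl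
  readCell true  sq    k       = refl
  readCell true  post₁ k       = refl
  readCell true  post₂ k       = validSuffix-accepts b c false k u

completions : Bool → Bool → Bool → ℕ → ℕ → ℕ
completions a     b c zero    k       = if accepts a b c k [] then 1 else 0
completions false b c (suc N) zero    = completions b c false N zero
completions false b c (suc N) (suc k) = completions b c false N (suc k) +ℕ completions b c true N k
completions true  b c (suc N) k       = completions b c false N k

count-accepts : ∀ a b c N k → count (accepts a b c k) (boards N) ≡ completions a b c N k
count-accepts a b c zero k = trans (count-∷ (accepts a b c k) [] []) (+-identityʳ _)
count-accepts a b c (suc N) k =
  trans (count-concatMap₃ (accepts a b c k) (sq ∷_) (post₁ ∷_) (post₂ ∷_) (boards N)) (firstCell a k)
  where
  open ≡-Reasoning
  none : count (λ (_ : List Cell) → false) (boards N) ≡ 0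
  none = count-false (boards N)
  firstCell : ∀ a k →
    count (λ t → accepts a b c k (sq ∷ t)) (boards N) +ℕ count (λ t → accepts a b c k (post₁ ∷ t)) (boards N)
      +ℕ count (λ t → accepts a b c k (post₂ ∷ t)) (boards N) ≡ completions a b c (suc N) k
  firstCell false zero = begin
    count (accepts b c false zero) (boards N) +ℕ count _ (boards N) +ℕ count _ (boards N)
      ≡⟨ cong₂ _+ℕ_ (cong₂ _+ℕ_ (count-accepts b c false N zero) none) none ⟩
    completions b c false N zero +ℕ 0 +ℕ 0
      ≡⟨ trans (+-identityʳ _) (+-identityʳ _) ⟩
    completions b c false N zero ∎
  firstCell false (suc k) = begin
    count (accepts b c false (suc k)) (boards N) +ℕ count (accepts b c true k) (boards N) +ℕ count _ (boards N)
      ≡⟨ cong₂ _+ℕ_ (cong₂ _+ℕ_ (count-accepts b c false N (suc k)) (count-accepts b c true N k)) none ⟩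
    completions b c false N (suc k) +ℕ completions b c true N k +ℕ 0
      ≡⟨ +-identityʳ _ ⟩
    completions b c false N (suc k) +ℕ completions b c true N k ∎
  firstCell true k = cong₂ _+ℕ_ (cong₂ _+ℕ_ none none) (count-accepts b c false N k)

free : ℕ → ℕ → ℕ
free = completions false false false

tilings≡free : ∀ N k → tilings N k ≡ free N k
tilings≡free N k = trans (count-cong validTiling-accepts (boards N)) (count-accepts false false false N k)
  where
  validTiling-accepts : ∀ t → ValidTiling t ∧ eqℕ (fences t) k ≡ accepts false false false k t
  validTiling-accepts t =
    trans (cong (_∧ eqℕ (fences t) k) (validTiling≡validSuffix t)) (validSuffix-accepts false false false k t)

-- Once the board has room for j further fences, a right post owed at cell 1 or
-- at cell 2 costs exactly one cell of the board, and owing both costs two.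
mutual
  pascal : ∀ j N → 2 +ℕ j *ℕ 3 ≤ℕ N → free (2 +ℕ N) (suc j) ≡ free (1 +ℕ N) (suc j) +ℕ free N j
  pascal j N h = cong (free (suc N) (suc j) +ℕ_) (pending₂ j N h)

  pending₂ : ∀ j N → 2 +ℕ j *ℕ 3 ≤ℕ N → completions false false true (suc N) j ≡ free N j
  pending₂ zero    (suc (suc M)) (s≤s (s≤s _)) = refl
  pending₂ (suc i) (suc (suc M)) (s≤s (s≤s h)) = begin
    completions false true false (2 +ℕ M) (suc i) +ℕ completions false true true (2 +ℕ M) i
      ≡⟨ cong₂ _+ℕ_ (pending₁ (suc i) (suc M) (s≤s h)) (pending₁₂ i M (<⇒≤ (<⇒≤ h))) ⟩
    free (1 +ℕ M) (suc i) +ℕ free M i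
      ≡⟨ sym (pascal i M (<⇒≤ h)) ⟩
    free (2 +ℕ M) (suc i) ∎
    where open ≡-Reasoning

  pending₁ : ∀ j N → 1 +ℕ j *ℕ 3 ≤ℕ N → completions false true false (suc N) j ≡ free N j
  pending₁ zero    (suc M)       (s≤s _)       = refl
  pending₁ (suc i) (suc (suc M)) (s≤s (s≤s h)) =
    trans (cong (free (1 +ℕ M) (suc i) +ℕ_) (pending₁ i M (<⇒≤ h))) (sym (pascal i M h))

  pending₁₂ : ∀ j N → 1 +ℕ j *ℕ 3 ≤ℕ N → completions false true true (2 +ℕ N) j ≡ free N j
  pending₁₂ zero    (suc M)       (s≤s _)       = refl
  pending₁₂ (suc i) (suc (suc M)) (s≤s (s≤s h)) = sym (pascal i M h)

tilings-pascal : ∀ N j → 2 +ℕ j *ℕ 3 ≤ℕ N →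
  tilings (2 +ℕ N) (suc j) ≡ tilings (1 +ℕ N) (suc j) +ℕ tilings N j
tilings-pascal N j h = begin
  tilings (2 +ℕ N) (suc j)                   ≡⟨ tilings≡free (2 +ℕ N) (suc j) ⟩
  free (2 +ℕ N) (suc j)                      ≡⟨ pascal j N h ⟩
  free (1 +ℕ N) (suc j) +ℕ free N j          ≡⟨ sym (cong₂ _+ℕ_ (tilings≡free (1 +ℕ N) (suc j)) (tilings≡free N j)) ⟩
  tilings (1 +ℕ N) (suc j) +ℕ tilings N j    ∎
  where open ≡-Reasoning

tilings-suc-unfenced : ∀ N → tilings (suc N) 0 ≡ tilings N 0
tilings-suc-unfenced N = trans (tilings≡free (suc N) 0) (sym (tilings≡free N 0))

board-room : ∀ m j → 2 *ℕ suc j +ℕ 1 ≤ℕ suc m → 2 +ℕ j *ℕ 3 ≤ℕ m +ℕ j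
board-room m j q = ≤-pred (subst (_≤ℕ suc m +ℕ j) (regroup j) (+-monoˡ-≤ j q))
  where
  regroup : ∀ j → 2 *ℕ suc j +ℕ 1 +ℕ j ≡ suc (2 +ℕ j *ℕ 3)
  regroup = solve-∀

corollary29 : (n k : ℤ) → + 0 ≤ k → + 2 * k + + 1 ≤ n →
    ⟨ n , k ⟩₃ ≡ ⟨ n - + 1 , k ⟩₃ +ℕ ⟨ n - + 1 , k - + 1 ⟩₃
corollary29 (+ zero)  (+ zero)  _ (+≤+ ())
corollary29 (+ zero)  (+ suc j) _ (+≤+ ())
corollary29 (+ suc m) (+ zero)  _ _       = trans (tilings-suc-unfenced (m +ℕ 0)) (sym (+-identityʳ _))
corollary29 (+ suc m) (+ suc j) _ (+≤+ q) = begin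
  tilings (suc (m +ℕ suc j)) (suc j)              ≡⟨ cong (λ N → tilings (suc N) (suc j)) (+-suc m j) ⟩
  tilings (2 +ℕ (m +ℕ j)) (suc j)                 ≡⟨ tilings-pascal (m +ℕ j) j (board-room m j q) ⟩
  tilings (1 +ℕ (m +ℕ j)) (suc j) +ℕ tilings (m +ℕ j) j
    ≡⟨ cong (λ N → tilings N (suc j) +ℕ tilings (m +ℕ j) j) (sym (+-suc m j)) ⟩
  tilings (m +ℕ suc j) (suc j) +ℕ tilings (m +ℕ j) j ∎
  where open ≡-Reasoning
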